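{- Let $T$ be a strongly $2$-connected tournament and $v\in V(T)$. Then there exists a covering edge for $v$.
   Context: A digraph $D$ is strongly $2$-connected if $|D|>2$ and $D-x$ is strongly connected for every vertex $x$ (and $D$ itself is strongly connected). A covering edge for $v$ is an edge $xy$ of $T$ such that $xv,vy\in E(T)$. -}

module Defs where

open import Data.Sum using (_⊎_)
open import Data.Unit using (⊤)
open import Data.Nat using (ℕ; _>_)
open import Data.Fin using (Fin)
open import Data.Product using (_×_; ∃-syntax)
open import Relation.Nullary using (¬_)
open import Relation.Binary.PropositionalEquality using (_≡_)

Digraph : ℕ → Set₁
Digraph n = Fin n → Fin n → Set

record IsTournament {n : ℕ} (E : Digraph n) : Set where
  field
    irrefl     : ∀ x → ¬ E x x
    total      : ∀ x y → ¬ x ≡ y → E x y ⊎ E y x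
    antisym    : ∀ x y → E x y → ¬ E y x

-- Directed walk from u to v in E using only vertices satisfying P
-- (both endpoints included).  This is reachability in the induced
-- subdigraph D[P].
data Walk {n : ℕ} (E : Digraph n) (P : Fin n → Set) : Fin n → Fin n → Set where
  here : ∀ {u} → P u → Walk E P u u
  step : ∀ {u w v} → P u → E u w → Walk E P w v → Walk E P u v

StronglyConnectedOn : {n : ℕ} → Digraph n → (Fin n → Set) → Set
StronglyConnectedOn E P = ∀ u v → P u → P v → Walk E P u v

StronglyConnected : {n : ℕ} → Digraph n → Set
StronglyConnected E = ∀ u v → Walk E (λ _ → ⊤) u v

record StronglyTwoConnected {n : ℕ} (E : Digraph n) : Set where
  field
    size>2   : n > 2
    strong   : StronglyConnected E
    strong-x : ∀ x → StronglyConnectedOn E (λ y → ¬ y ≡ x)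

CoveringEdge : {n : ℕ} → Digraph n → Fin n → Set
CoveringEdge E v = ∃[ x ] ∃[ y ] (E x y × E x v × E v y)

-- Pick an in-neighbour x and an out-neighbour y of v (they exist because T is
-- strongly connected and has a vertex other than v), and a path from x to y in
-- T - v.  Along that path v dominates the start and is dominated by the end, so
-- at the first vertex b that v dominates, the preceding edge a → b has a → v.
module Submission where

open import Defs
open import Data.Nat using (ℕ; _<_; s≤s)
open import Data.Nat.Properties using (≤-trans; n≤1+n)
open import Data.Fin using (Fin; zero; suc)
open import Data.Product using (_,_; ∃-syntax)
open import Data.Sum using (inj₁; inj₂)
open import Data.Empty using (⊥-elim)
open import Relation.Binary.PropositionalEquality using (_≡_; _≢_; refl; ≢-sym)

module _ {n : ℕ} {E : Digraph n} {P : Fin n → Set} where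

  Walk-source : ∀ {a b} → Walk E P a b → P a
  Walk-source (here pa)     = pa
  Walk-source (step pa _ _) = pa

  Walk-first-edge : ∀ {a b} → a ≢ b → Walk E P a b → ∃[ c ] E a c
  Walk-first-edge a≢b (here _)      = ⊥-elim (a≢b refl)
  Walk-first-edge a≢b (step _ ac _) = _ , ac

  edge-Walk-last-edge : ∀ {a c b} → E a c → Walk E P c b → ∃[ x ] E x b
  edge-Walk-last-edge ac (here _)      = _ , ac
  edge-Walk-last-edge _  (step _ cd w) = edge-Walk-last-edge cd w

  Walk-last-edge : ∀ {a b} → a ≢ b → Walk E P a b → ∃[ c ] E c b
  Walk-last-edge a≢b (here _)      = ⊥-elim (a≢b refl)
  Walk-last-edge a≢b (step _ ac w) = edge-Walk-last-edge ac w

other-vertex : ∀ {n} → 1 < n → (v : Fin n) → ∃[ u ] u ≢ v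
other-vertex (s≤s (s≤s _)) zero    = suc zero , λ ()
other-vertex (s≤s (s≤s _)) (suc v) = zero , λ ()

module _ {n : ℕ} {T : Digraph n} (tour : IsTournament T) where
  open IsTournament tour

  edge⇒≢ : ∀ {x y} → T x y → x ≢ y
  edge⇒≢ xy refl = irrefl _ xy

  covering-edge-on-Walk : ∀ {v x y} → T x v → T v y →
                          Walk T (_≢ v) x y → CoveringEdge T v
  covering-edge-on-Walk xv vy (here _) = ⊥-elim (antisym _ _ xv vy)
  covering-edge-on-Walk {v} {x} xv vy (step _ xb w) with total _ v (Walk-source w)
  ... | inj₁ bv = covering-edge-on-Walk bv vy w
  ... | inj₂ vb = x , _ , xb , xv , vb

open StronglyTwoConnected

lemma8p1 : {n : ℕ} (T : Digraph n) → IsTournament T → StronglyTwoConnected T →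
           (v : Fin n) → CoveringEdge T v
lemma8p1 T tour s2 v with other-vertex (≤-trans (n≤1+n 2) (size>2 s2)) v
... | u , u≢v with Walk-first-edge (≢-sym u≢v) (strong s2 v u)
                 | Walk-last-edge u≢v (strong s2 u v)
... | y , vy | x , xv =
  covering-edge-on-Walk tour xv vy
    (strong-x s2 v x y (edge⇒≢ tour xv) (≢-sym (edge⇒≢ tour vy)))
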